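{- Let $b\in\mathbb{Q}$, let $\phi(x,y)=(y,\,x+y^2+b)$, and suppose that $\phi$ has a periodic point $Q\in\mathbb{A}^2(\mathbb{Q})$. Then the denominator of $b$ (in lowest terms) is a perfect square, and $h(Q)\leq\frac12h(b)+\log3$.
   Context: Heights are absolute logarithmic heights: for $b\in\mathbb{Q}$, $h(b)=\sum_v\log\max\{1,|b|_v\}$, and for $Q=(x,y)$, $h(Q)=\sum_v\log\max\{1,|x|_v,|y|_v\}$, the sums over all places $v$ of $\mathbb{Q}$. $Q$ is periodic if $\phi^n(Q)=Q$ for some $n\geq1$. -}

module Defs where

open import Data.Nat using (ℕ; zero; suc)
import Data.Nat as ℕ
open import Data.Nat.LCM using (lcm)
open import Data.Integer using (+_)
open import Data.Rational using (ℚ; _+_; _*_; _⊔_; ∣_∣; 1ℚ; _/_; ↧ₙ_)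
open import Data.Product using (_×_; _,_; ∃-syntax)
open import Relation.Binary.PropositionalEquality using (_≡_)

φ : ℚ → ℚ × ℚ → ℚ × ℚ
φ b (x , y) = (y , x + y * y + b)

iter : {A : Set} → (A → A) → ℕ → A → A
iter f zero    a = a
iter f (suc n) a = f (iter f n a)

IsPeriodic : ℚ → ℚ × ℚ → Set
IsPeriodic b Q = ∃[ n ] (1 ℕ.≤ n × iter (φ b) n Q ≡ Q)

ℕ→ℚ : ℕ → ℚ
ℕ→ℚ n = + n / 1

-- Multiplicative heights H = exp ∘ h.
-- For b ∈ ℚ: ∏_v max{1,|b|_v} = (∏_p max{1,|b|_p}) · max{1,|b|_∞}
--   and the non-archimedean product equals the denominator of b.
Hb : ℚ → ℚ
Hb b = ℕ→ℚ (↧ₙ b) * (1ℚ ⊔ ∣ b ∣)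

-- For Q = (x,y): ∏_p max{1,|x|_p,|y|_p} = lcm(den x, den y), times the
-- archimedean factor max{1,|x|,|y|}.
HQ : ℚ × ℚ → ℚ
HQ (x , y) = ℕ→ℚ (lcm (↧ₙ x) (↧ₙ y)) * (1ℚ ⊔ (∣ x ∣ ⊔ ∣ y ∣))

IsSquare : ℕ → Set
IsSquare n = ∃[ k ] (n ≡ k ℕ.* k)

{-# OPTIONS --safe #-}
-- Write the orbit as the periodic sequence xⱼ with xⱼ₊₂ = xⱼ + xⱼ₊₁² + b. If L is a common
-- denominator of all xⱼ, the integers aⱼ = L xⱼ satisfy L aⱼ₊₂ = L aⱼ + aⱼ₊₁² + b L², so
-- b L² is an integer and den b ∣ L². If a prime p divides k = L² / den b, then p ∣ L and
-- p ∣ b L² = num b · k, hence p ∣ aⱼ₊₁² and p ∣ aⱼ₊₁; since every xⱼ recurs at a positive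
-- index, L / p is again a common denominator. Descending on L ends with L² = den b.
-- At an index where |xⱼ₊₁| attains its maximum M we get M² ≤ 2M + |b|, hence
-- max(1, M)² ≤ 9 max(1, |b|); together with lcm(den x₀, den x₁) ≤ L this bounds H(Q)².
module Submission where

open import Defs
open import Data.Rational using (ℚ; _≤_; _*_; _/_)
open import Data.Integer using (+_)
open import Data.Rational using (↧ₙ_)
open import Data.Product using (_×_)

open import Data.Integer as ℤ using (ℤ; -[1+_])
import Data.Integer.Properties as ℤ
import Data.Integer.Divisibility.Signed as ℤ∣
open import Data.Integer.Divisibility.Signed
  using (∣ᵤ⇒∣; ∣⇒∣ᵤ; ∣m∣n⇒∣m-n; ∣m⇒∣m*n; ∣n⇒∣m*n) renaming (_∣_ to _∣ℤ_)
open import Data.Integer.Solver renaming (module +-*-Solver to ℤ-Solver)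
open import Data.List using ([]; _∷_; map; upTo)
open import Data.List.Membership.Propositional.Properties using (∈-map⁺; ∈-upTo⁺)
import Data.List.Relation.Unary.All as All
import Data.List.Relation.Unary.All.Properties as All
open import Data.List.Relation.Unary.Any using (here)
open import Data.Nat as ℕ using (ℕ; zero; suc; NonZero)
import Data.Nat.Properties as ℕ
open import Data.Nat.Coprimality using (Coprime; coprime-divisor; coprime?)
import Data.Nat.Coprimality as Coprime
open import Data.Nat.Divisibility
  using (_∣_; module _∣_; divides; quotient; ∣-trans; ∣⇒≤; quotient-∣; quotient-<; quotient≢0)
open import Data.Nat.Induction using (<-rec)
open import Data.Nat.LCM using (lcm; lcm-least)
open import Data.Nat.ListAction using (product)
open import Data.Nat.ListAction.Properties using (∈⇒∣product; product≢0)
open import Data.Nat.Primality using (Prime; euclidsLemma; prime⇒nonZero; prime⇒nonTrivial)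
open import Data.Nat.Primality.Factorisation using (factorise)
open import Data.Product using (Σ; ∃-syntax; _,_; proj₁; proj₂; map₂)
open import Data.Rational as ℚ using (mkℚ; ↥_; ↧_; _+_; _-_; -_; ∣_∣; 0ℚ; 1ℚ; _⊔_)
import Data.Rational.Properties as ℚ
open import Relation.Binary.Bundles using (DecTotalOrder)
open import Data.List.Extrema (DecTotalOrder.totalOrder ℚ.≤-decTotalOrder) using (argmax; f[xs]≤f[argmax])
open import Data.Rational.Solver using (module +-*-Solver)
import Data.Rational.Unnormalised as ℚᵘ
open import Data.Sum using (_⊎_; inj₁; inj₂; [_,_]′)
open import Function.Base using (_∘_; id)
open import Function.Bundles using (_⇔_; mk⇔; Equivalence)
open import Relation.Nullary.Decidable using (recompute)
open import Relation.Binary.PropositionalEquality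

fromℤ : ℤ → ℚ
fromℤ z = z / 1

coprime-1 : ∀ n → Coprime n 1
coprime-1 n = Coprime.sym (Coprime.1-coprimeTo n)

fromℤ≡mkℚ : ∀ z → fromℤ z ≡ mkℚ z 0 (coprime-1 ℤ.∣ z ∣)
fromℤ≡mkℚ (+ n)    = ℚ.normalize-coprime (coprime-1 n)
fromℤ≡mkℚ -[1+ n ] = cong -_ (ℚ.normalize-coprime (coprime-1 (suc n)))

fromℤ-injective : ∀ {z w} → fromℤ z ≡ fromℤ w → z ≡ w
fromℤ-injective {z} {w} eq rewrite fromℤ≡mkℚ z | fromℤ≡mkℚ w = cong ↥_ eq

fromℤ-homo-* : ∀ z w → fromℤ (z ℤ.* w) ≡ fromℤ z * fromℤ w
fromℤ-homo-* z w rewrite fromℤ≡mkℚ z | fromℤ≡mkℚ w = refl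

fromℤ-homo-+ : ∀ z w → fromℤ (z ℤ.+ w) ≡ fromℤ z + fromℤ w
fromℤ-homo-+ z w rewrite fromℤ≡mkℚ z | fromℤ≡mkℚ w =
  cong (_/ 1) (sym (cong₂ ℤ._+_ (ℤ.*-identityʳ z) (ℤ.*-identityʳ w)))

fromℤ-homo‿- : ∀ z → fromℤ (ℤ.- z) ≡ - fromℤ z
fromℤ-homo‿- (+ zero)  = refl
fromℤ-homo‿- (+ suc n) = refl
fromℤ-homo‿- -[1+ n ]  rewrite fromℤ≡mkℚ (+ suc n) = refl

fromℤ-homo-sub : ∀ z w → fromℤ (z ℤ.- w) ≡ fromℤ z - fromℤ w
fromℤ-homo-sub z w = trans (fromℤ-homo-+ z (ℤ.- w)) (cong (λ q → fromℤ z + q) (fromℤ-homo‿- w))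

ℕ→ℚ-homo-* : ∀ m n → ℕ→ℚ (m ℕ.* n) ≡ ℕ→ℚ m * ℕ→ℚ n
ℕ→ℚ-homo-* m n = trans (cong fromℤ (ℤ.pos-* m n)) (fromℤ-homo-* (+ m) (+ n))

ℕ→ℚ-mono-≤ : ∀ {m n} → m ℕ.≤ n → ℕ→ℚ m ≤ ℕ→ℚ n
ℕ→ℚ-mono-≤ {m} {n} m≤n rewrite fromℤ≡mkℚ (+ m) | fromℤ≡mkℚ (+ n) =
  ℚ.*≤* (ℤ.*-monoʳ-≤-nonNeg (+ 1) (ℤ.+≤+ m≤n))

*ℕ→ℚ≡fromℤ⇔ : ∀ q n c → (q * ℕ→ℚ n ≡ fromℤ c) ⇔ (↥ q ℤ.* + n ≡ c ℤ.* ↧ q)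
*ℕ→ℚ≡fromℤ⇔ (mkℚ r d _) n c rewrite fromℤ≡mkℚ (+ n) | ℕ.*-identityʳ d = mk⇔
  (λ eq → drop (ℚ./-injective-≃ rn/d c/1 eq))
  (λ eq → ℚ.fromℚᵘ-cong {rn/d} {c/1} (ℚᵘ.*≡* (trans (ℤ.*-identityʳ (r ℤ.* + n)) eq)))
  where
  rn/d = ℚᵘ.mkℚᵘ (r ℤ.* + n) d
  c/1  = ℚᵘ.mkℚᵘ c 0
  drop : rn/d ℚᵘ.≃ c/1 → r ℤ.* + n ≡ c ℤ.* + suc d
  drop (ℚᵘ.*≡* eq) = trans (sym (ℤ.*-identityʳ (r ℤ.* + n))) eq

↥q*n≡c*↧q⇒↧q∣n : ∀ q {n} c → ↥ q ℤ.* + n ≡ c ℤ.* ↧ q → ↧ₙ q ∣ n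
↥q*n≡c*↧q⇒↧q∣n (mkℚ r d coprime) {n} c eq =
  coprime-divisor (Coprime.sym (recompute (coprime? _ _) coprime)) (divides ℤ.∣ c ∣ (begin
    ℤ.∣ r ∣ ℕ.* n        ≡⟨ ℤ.abs-* r (+ n) ⟨
    ℤ.∣ r ℤ.* + n ∣      ≡⟨ cong ℤ.∣_∣ eq ⟩
    ℤ.∣ c ℤ.* + suc d ∣  ≡⟨ ℤ.abs-* c (+ suc d) ⟩
    ℤ.∣ c ∣ ℕ.* suc d    ∎))
  where open ≡-Reasoning

*≡fromℤ⇒↧∣ : ∀ q {n} c → q * ℕ→ℚ n ≡ fromℤ c → ↧ₙ q ∣ n
*≡fromℤ⇒↧∣ q {n} c = ↥q*n≡c*↧q⇒↧q∣n q c ∘ Equivalence.to (*ℕ→ℚ≡fromℤ⇔ q n c)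

↧∣⇒*≡fromℤ : ∀ q {n} (↧q∣n : ↧ₙ q ∣ n) → q * ℕ→ℚ n ≡ fromℤ (↥ q ℤ.* + quotient ↧q∣n)
↧∣⇒*≡fromℤ q {n} (divides k n≡k*↧q) = Equivalence.from (*ℕ→ℚ≡fromℤ⇔ q n (↥ q ℤ.* + k)) (begin
  ↥ q ℤ.* + n             ≡⟨ cong (λ m → ↥ q ℤ.* + m) n≡k*↧q ⟩
  ↥ q ℤ.* + (k ℕ.* ↧ₙ q)  ≡⟨ cong (↥ q ℤ.*_) (ℤ.pos-* k (↧ₙ q)) ⟩
  ↥ q ℤ.* (+ k ℤ.* ↧ q)   ≡⟨ ℤ.*-assoc (↥ q) (+ k) (↧ q) ⟨
  ↥ q ℤ.* + k ℤ.* ↧ q     ∎)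
  where open ≡-Reasoning

prime∣z*z⇒prime∣z : ∀ {p z} → Prime p → + p ∣ℤ z ℤ.* z → + p ∣ℤ z
prime∣z*z⇒prime∣z {p} {z} prime-p p∣z*z = ∣ᵤ⇒∣
  ([ id , id ]′ (euclidsLemma ℤ.∣ z ∣ ℤ.∣ z ∣ prime-p (subst (p ∣_) (ℤ.abs-* z z) (∣⇒∣ᵤ p∣z*z))))

one-or-prime-factor : ∀ n .{{_ : NonZero n}} → n ≡ 1 ⊎ ∃[ p ] Prime p × p ∣ n
one-or-prime-factor n with factorise n
... | record { factors = [] ; isFactorisation = n≡1 } = inj₁ n≡1
... | record { factors = p ∷ ps ; isFactorisation = n≡p*Πps ; factorsPrime = prime-p All.∷ _ } =
  inj₂ (p , prime-p , subst (p ∣_) (sym n≡p*Πps) (∈⇒∣product {ns = p ∷ ps} (here refl)))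

iter-periodic : ∀ {A : Set} (f : A → A) {a n} → iter f (suc n) a ≡ a →
                ∀ j → ∃[ i ] i ℕ.< suc n × iter f j a ≡ iter f (suc i) a
iter-periodic f {n = n} returns zero = n , ℕ.≤-refl , sym returns
iter-periodic f returns (suc j) with iter-periodic f returns j
... | i , i<n , eq with ℕ.m≤n⇒m<n∨m≡n i<n
...   | inj₁ 1+i<n = suc i , 1+i<n , cong f eq
...   | inj₂ refl  = 0 , ℕ.z<s , cong f (trans eq returns)

module QuadraticRecurrence (b : ℚ) (x : ℕ → ℚ)
  (recurrence : ∀ j → x (suc (suc j)) ≡ x j + x (suc j) * x (suc j) + b)
  (recurs : ∀ j → ∃[ i ] x j ≡ x (suc i)) where

  CommonDenominator : ℕ → Set
  CommonDenominator L = ∀ j → ↧ₙ (x j) ∣ L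

  module Numerators {L : ℕ} (common : CommonDenominator L) where

    a : ℕ → ℤ
    a j = ↥ (x j) ℤ.* + quotient (common j)

    x*L≡a : ∀ j → x j * ℕ→ℚ L ≡ fromℤ (a j)
    x*L≡a j = ↧∣⇒*≡fromℤ (x j) (common j)

    L*Δa : ℕ → ℤ
    L*Δa j = + L ℤ.* (a (suc (suc j)) ℤ.- a j)

    b*L²≡L*Δa-a*a : ∀ j → b * ℕ→ℚ (L ℕ.* L) ≡ fromℤ (L*Δa j ℤ.- a (suc j) ℤ.* a (suc j))
    b*L²≡L*Δa-a*a j = begin
      b * ℕ→ℚ (L ℕ.* L)
        ≡⟨ cong (b *_) (ℕ→ℚ-homo-* L L) ⟩
      b * (l * l)
        ≡⟨ scaled (x j) (x (suc j)) b l ⟩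
      l * ((x j + x (suc j) * x (suc j) + b) * l - x j * l) - (x (suc j) * l) * (x (suc j) * l)
        ≡⟨ cong (λ u → l * (u * l - x j * l) - (x (suc j) * l) * (x (suc j) * l)) (recurrence j) ⟨
      l * (x (suc (suc j)) * l - x j * l) - (x (suc j) * l) * (x (suc j) * l)
        ≡⟨ cong₂ (λ u v → l * u - v) (cong₂ _-_ (x*L≡a (suc (suc j))) (x*L≡a j))
                                     (cong₂ _*_ (x*L≡a (suc j)) (x*L≡a (suc j))) ⟩
      l * (fromℤ a₂ - fromℤ a₀) - fromℤ a₁ * fromℤ a₁
        ≡⟨ cong₂ _-_ (cong (l *_) (fromℤ-homo-sub a₂ a₀)) (fromℤ-homo-* a₁ a₁) ⟨
      l * fromℤ (a₂ ℤ.- a₀) - fromℤ (a₁ ℤ.* a₁)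
        ≡⟨ cong (_- fromℤ (a₁ ℤ.* a₁)) (fromℤ-homo-* (+ L) (a₂ ℤ.- a₀)) ⟨
      fromℤ (L*Δa j) - fromℤ (a₁ ℤ.* a₁)
        ≡⟨ fromℤ-homo-sub (L*Δa j) (a₁ ℤ.* a₁) ⟨
      fromℤ (L*Δa j ℤ.- a₁ ℤ.* a₁) ∎
      where
      open ≡-Reasoning
      l = ℕ→ℚ L
      a₀ = a j
      a₁ = a (suc j)
      a₂ = a (suc (suc j))
      scaled : ∀ u y c l → c * (l * l) ≡ l * ((u + y * y + c) * l - u * l) - (y * l) * (y * l)
      scaled = solve 4 (λ u y c l →
        c :* (l :* l) := l :* ((u :+ y :* y :+ c) :* l :- u :* l) :- (y :* l) :* (y :* l)) refl
        where open +-*-Solver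

  ↧b∣L² : ∀ {L} → CommonDenominator L → ↧ₙ b ∣ L ℕ.* L
  ↧b∣L² common = *≡fromℤ⇒↧∣ b (L*Δa 0 ℤ.- a 1 ℤ.* a 1) (b*L²≡L*Δa-a*a 0)
    where open Numerators common

  descend : ∀ {L p} (common : CommonDenominator L) → Prime p → p ∣ quotient (↧b∣L² common) →
            Σ (p ∣ L) λ p∣L → CommonDenominator (quotient p∣L)
  descend {L} {p} common prime-p p∣k = p∣L , common₁
    where
    open Numerators common
    k = quotient (↧b∣L² common)
    B = ↥ b ℤ.* + k

    p∣L : p ∣ L
    p∣L = [ id , id ]′ (euclidsLemma L L prime-p (∣-trans p∣k (quotient-∣ (↧b∣L² common))))

    a*a≡L*Δa-B : ∀ j → a (suc j) ℤ.* a (suc j) ≡ L*Δa j ℤ.- B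
    a*a≡L*Δa-B j = trans (n≡m-[m-n] (L*Δa j) (a (suc j) ℤ.* a (suc j))) (cong (ℤ._-_ (L*Δa j))
      (fromℤ-injective (trans (sym (b*L²≡L*Δa-a*a j)) (↧∣⇒*≡fromℤ b (↧b∣L² common)))))
      where
      n≡m-[m-n] : ∀ m n → n ≡ m ℤ.- (m ℤ.- n)
      n≡m-[m-n] = solve 2 (λ m n → n := m :- (m :- n)) refl
        where open ℤ-Solver

    p∣a : ∀ j → + p ∣ℤ a (suc j)
    p∣a j = prime∣z*z⇒prime∣z prime-p (subst (+ p ∣ℤ_) (sym (a*a≡L*Δa-B j))
      (∣m∣n⇒∣m-n {m = L*Δa j} {n = B}
        (∣m⇒∣m*n (a (suc (suc j)) ℤ.- a j) (∣ᵤ⇒∣ {i = + L} p∣L)) (∣n⇒∣m*n (↥ b) (∣ᵤ⇒∣ {i = + k} p∣k))))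

    L₁ = quotient p∣L

    common₁-suc : ∀ j → ↧ₙ (x (suc j)) ∣ L₁
    common₁-suc j = ↥q*n≡c*↧q⇒↧q∣n x₁ c (ℤ.*-cancelʳ-≡ (↥ x₁ ℤ.* + L₁) (c ℤ.* ↧ x₁) (+ p) (begin
      ↥ x₁ ℤ.* + L₁ ℤ.* + p    ≡⟨ ℤ.*-assoc (↥ x₁) (+ L₁) (+ p) ⟩
      ↥ x₁ ℤ.* (+ L₁ ℤ.* + p)  ≡⟨ cong (↥ x₁ ℤ.*_) (ℤ.pos-* L₁ p) ⟨
      ↥ x₁ ℤ.* + (L₁ ℕ.* p)    ≡⟨ cong (λ n → ↥ x₁ ℤ.* + n) (_∣_.equality p∣L) ⟨
      ↥ x₁ ℤ.* + L             ≡⟨ Equivalence.to (*ℕ→ℚ≡fromℤ⇔ x₁ L (a (suc j))) (x*L≡a (suc j)) ⟩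
      a (suc j) ℤ.* ↧ x₁       ≡⟨ cong (ℤ._* ↧ x₁) (ℤ∣._∣_.equality (p∣a j)) ⟩
      c ℤ.* + p ℤ.* ↧ x₁       ≡⟨ right-comm c (+ p) (↧ x₁) ⟩
      c ℤ.* ↧ x₁ ℤ.* + p       ∎))
      where
      open ≡-Reasoning
      instance _ = prime⇒nonZero prime-p
      x₁ = x (suc j)
      c = ℤ∣._∣_.quotient (p∣a j)
      right-comm : ∀ u v w → u ℤ.* v ℤ.* w ≡ u ℤ.* w ℤ.* v
      right-comm = solve 3 (λ u v w → u :* v :* w := u :* w :* v) refl
        where open ℤ-Solver

    common₁ : CommonDenominator L₁
    common₁ j = subst (λ q → ↧ₙ q ∣ L₁) (sym (proj₂ (recurs j))) (common₁-suc (proj₁ (recurs j)))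

  SquareDenominator : Set
  SquareDenominator = ∃[ M ] M ℕ.* M ≡ ↧ₙ b × CommonDenominator M

  common⇒square : ∀ L → .{{NonZero L}} → CommonDenominator L → SquareDenominator
  common⇒square = <-rec (λ L → .{{NonZero L}} → CommonDenominator L → SquareDenominator) go
    where
    go : ∀ L → (∀ {L₁} → L₁ ℕ.< L → .{{NonZero L₁}} → CommonDenominator L₁ → SquareDenominator) →
         .{{NonZero L}} → CommonDenominator L → SquareDenominator
    go L rec common = [ square , smaller ]′ (one-or-prime-factor k {{k≢0}})
      where
      L²∣ = ↧b∣L² common
      k = quotient L²∣
      k≢0 : NonZero k
      k≢0 = ℕ.m*n≢0⇒m≢0 k {{subst NonZero (_∣_.equality L²∣) (ℕ.m*n≢0 L L)}}
      square : k ≡ 1 → SquareDenominator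
      square k≡1 =
        L , trans (_∣_.equality L²∣) (trans (cong (ℕ._* ↧ₙ b) k≡1) (ℕ.*-identityˡ (↧ₙ b))) , common
      smaller : ∃[ p ] Prime p × p ∣ k → SquareDenominator
      smaller (p , prime-p , p∣k) = rec (quotient-< p∣L) {{quotient≢0 p∣L}} common₁
        where
        instance _ = prime⇒nonTrivial prime-p
        p∣L = proj₁ (descend common prime-p p∣k)
        common₁ = proj₂ (descend common prime-p p∣k)

*-mono-≤-nonNeg : ∀ {p q r s} → 0ℚ ≤ p → p ≤ q → 0ℚ ≤ r → r ≤ s → p * r ≤ q * s
*-mono-≤-nonNeg {q = q} {r = r} 0≤p p≤q 0≤r r≤s = ℚ.≤-trans
  (ℚ.*-monoʳ-≤-nonNeg r {{ℚ.nonNegative 0≤r}} p≤q)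
  (ℚ.*-monoˡ-≤-nonNeg q {{ℚ.nonNegative (ℚ.≤-trans 0≤p p≤q)}} r≤s)

0≤p*p : ∀ p → 0ℚ ≤ p * p
0≤p*p p = subst (_≤ p * p) (ℚ.*-zeroˡ p) (0*p≤p*p (ℚ.≤-total 0ℚ p))
  where
  0*p≤p*p : 0ℚ ≤ p ⊎ p ≤ 0ℚ → 0ℚ * p ≤ p * p
  0*p≤p*p (inj₁ 0≤p) = ℚ.*-monoʳ-≤-nonNeg p {{ℚ.nonNegative 0≤p}} 0≤p
  0*p≤p*p (inj₂ p≤0) = ℚ.*-monoʳ-≤-nonPos p {{ℚ.nonPositive p≤0}} p≤0

∣y∣*∣y∣≤∣u∣+∣v∣+∣c∣ : ∀ {u v y c} → u ≡ v + y * y + c → ∣ y ∣ * ∣ y ∣ ≤ ∣ u ∣ + ∣ v ∣ + ∣ c ∣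
∣y∣*∣y∣≤∣u∣+∣v∣+∣c∣ {u} {v} {y} {c} refl = begin
  ∣ y ∣ * ∣ y ∣          ≡⟨ ℚ.∣p*q∣≡∣p∣*∣q∣ y y ⟨
  ∣ y * y ∣              ≡⟨ cong ∣_∣ (solve 3 (λ v y c → y :* y := v :+ y :* y :+ c :- v :- c) refl v y c) ⟩
  ∣ u - v - c ∣          ≤⟨ ℚ.∣p-q∣≤∣p∣+∣q∣ (u - v) c ⟩
  ∣ u - v ∣ + ∣ c ∣      ≤⟨ ℚ.+-monoˡ-≤ ∣ c ∣ (ℚ.∣p-q∣≤∣p∣+∣q∣ u v) ⟩
  ∣ u ∣ + ∣ v ∣ + ∣ c ∣  ∎
  where
  open ℚ.≤-Reasoning
  open +-*-Solver

-- AM-GM: 4m ≤ m² + 4, because (m - 2)² ≥ 0.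
m*m≤m+m+c⇒m*m≤4+c+c : ∀ {m c} → m * m ≤ m + m + c → m * m ≤ ℕ→ℚ 4 + c + c
m*m≤m+m+c⇒m*m≤4+c+c {m} {c} m*m≤m+m+c = begin
  m * m                                     ≡⟨ solve 1 (λ m → m :* m := m :* m :+ m :* m :- m :* m) refl m ⟩
  m * m + m * m - m * m                     ≤⟨ ℚ.+-monoˡ-≤ (- (m * m)) (ℚ.+-mono-≤ m*m≤m+m+c m*m≤m+m+c) ⟩
  (m + m + c) + (m + m + c) - m * m         ≡⟨ solve 2 (λ m c → (m :+ m :+ c) :+ (m :+ m :+ c) :- m :* m
                                                 := con (ℕ→ℚ 4) :+ c :+ c :- (m :- con (ℕ→ℚ 2)) :* (m :- con (ℕ→ℚ 2)))
                                                 refl m c ⟩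
  ℕ→ℚ 4 + c + c - (m - ℕ→ℚ 2) * (m - ℕ→ℚ 2) ≤⟨ ℚ.+-monoʳ-≤ (ℕ→ℚ 4 + c + c) (ℚ.neg-antimono-≤ (0≤p*p (m - ℕ→ℚ 2))) ⟩
  ℕ→ℚ 4 + c + c - 0ℚ                        ≡⟨ ℚ.+-identityʳ (ℕ→ℚ 4 + c + c) ⟩
  ℕ→ℚ 4 + c + c                             ∎
  where
  open ℚ.≤-Reasoning
  open +-*-Solver

4+c+c≤9*[1⊔c] : ∀ c → ℕ→ℚ 4 + c + c ≤ ℕ→ℚ 9 * (1ℚ ⊔ c)
4+c+c≤9*[1⊔c] c = begin
  ℕ→ℚ 4 + c + c      ≤⟨ ℚ.+-mono-≤ (ℚ.+-mono-≤ 4≤4*C c≤C) c≤C ⟩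
  ℕ→ℚ 4 * C + C + C  ≡⟨ solve 1 (λ C → con (ℕ→ℚ 4) :* C :+ C :+ C := con (ℕ→ℚ 6) :* C) refl C ⟩
  ℕ→ℚ 6 * C          ≤⟨ ℚ.*-monoʳ-≤-nonNeg C {{ℚ.nonNegative 0≤C}} (ℕ→ℚ-mono-≤ (ℕ.m≤m+n 6 3)) ⟩
  ℕ→ℚ 9 * C          ∎
  where
  open ℚ.≤-Reasoning
  open +-*-Solver
  C = 1ℚ ⊔ c
  1≤C = ℚ.p≤p⊔q 1ℚ c
  c≤C = ℚ.p≤q⊔p 1ℚ c
  0≤C = ℚ.≤-trans (ℕ→ℚ-mono-≤ {0} {1} ℕ.z≤n) 1≤C
  4≤4*C : ℕ→ℚ 4 ≤ ℕ→ℚ 4 * C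
  4≤4*C = ℚ.*-monoˡ-≤-nonNeg (ℕ→ℚ 4) {{_}} 1≤C

⊔-square-bound : ∀ {m c} → 0ℚ ≤ c → m * m ≤ m + m + c → (1ℚ ⊔ m) * (1ℚ ⊔ m) ≤ ℕ→ℚ 9 * (1ℚ ⊔ c)
⊔-square-bound {m} {c} 0≤c m*m≤m+m+c = ℚ.≤-trans (bound (ℚ.⊔-sel 1ℚ m)) (4+c+c≤9*[1⊔c] c)
  where
  bound : (1ℚ ⊔ m ≡ 1ℚ) ⊎ (1ℚ ⊔ m ≡ m) → (1ℚ ⊔ m) * (1ℚ ⊔ m) ≤ ℕ→ℚ 4 + c + c
  bound (inj₁ eq) rewrite eq = ℚ.+-mono-≤ (ℚ.+-mono-≤ (ℕ→ℚ-mono-≤ {1} {4} (ℕ.m≤m+n 1 3)) 0≤c) 0≤c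
  bound (inj₂ eq) rewrite eq = m*m≤m+m+c⇒m*m≤4+c+c {m} {c} m*m≤m+m+c

module PeriodicOrbit (b : ℚ) (Q : ℚ × ℚ) (n : ℕ) (periodic : iter (φ b) (suc n) Q ≡ Q) where

  x : ℕ → ℚ
  x j = proj₁ (iter (φ b) j Q)

  returns : ∀ j → ∃[ i ] i ℕ.< suc n × x j ≡ x (suc i)
  returns j = map₂ (map₂ (cong proj₁)) (iter-periodic (φ b) periodic j)

  open QuadraticRecurrence b x (λ _ → refl) (map₂ proj₂ ∘ returns)

  orbitDenominator : ℕ
  orbitDenominator = product (map (λ i → ↧ₙ (x (suc i))) (upTo (suc n)))

  instance
    orbitDenominator≢0 : NonZero orbitDenominator
    orbitDenominator≢0 = product≢0 (All.map⁺ (All.universal (λ _ → ℕ.nonZero) (upTo (suc n))))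

  orbitDenominator-common : CommonDenominator orbitDenominator
  orbitDenominator-common j =
    let (i , i<n , xⱼ≡xᵢ₊₁) = returns j in
    subst (λ q → ↧ₙ q ∣ orbitDenominator) (sym xⱼ≡xᵢ₊₁)
          (∈⇒∣product (∈-map⁺ (λ i → ↧ₙ (x (suc i))) (∈-upTo⁺ i<n)))

  peak : ℕ
  peak = argmax (∣_∣ ∘ x ∘ suc) 0 (upTo (suc n))

  M : ℚ
  M = ∣ x (suc peak) ∣

  ∣x∣≤M : ∀ j → ∣ x j ∣ ≤ M
  ∣x∣≤M j =
    let (i , i<n , xⱼ≡xᵢ₊₁) = returns j in
    subst (λ q → ∣ q ∣ ≤ M) (sym xⱼ≡xᵢ₊₁)
          (All.lookup (f[xs]≤f[argmax] {f = ∣_∣ ∘ x ∘ suc} 0 (upTo (suc n))) (∈-upTo⁺ i<n))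

  M*M≤M+M+∣b∣ : M * M ≤ M + M + ∣ b ∣
  M*M≤M+M+∣b∣ = ℚ.≤-trans (∣y∣*∣y∣≤∣u∣+∣v∣+∣c∣ {x (suc (suc peak))} {x peak} {x (suc peak)} {b} refl)
                          (ℚ.+-monoˡ-≤ ∣ b ∣ (ℚ.+-mono-≤ (∣x∣≤M (suc (suc peak))) (∣x∣≤M peak)))

  height-bound : SquareDenominator → HQ Q * HQ Q ≤ ℕ→ℚ 9 * Hb b
  height-bound (L , L*L≡↧b , common) = begin
    (l * A) * (l * A)          ≡⟨ solve 2 (λ l A → (l :* A) :* (l :* A) := (l :* l) :* (A :* A)) refl l A ⟩
    (l * l) * (A * A)          ≤⟨ *-mono-≤-nonNeg (0≤p*p l) l*l≤↧b (0≤p*p A) A*A≤9*C ⟩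
    ℕ→ℚ (↧ₙ b) * (ℕ→ℚ 9 * C)  ≡⟨ solve 3 (λ d k C → d :* (k :* C) := k :* (d :* C)) refl (ℕ→ℚ (↧ₙ b)) (ℕ→ℚ 9) C ⟩
    ℕ→ℚ 9 * Hb b              ∎
    where
    open ℚ.≤-Reasoning
    open +-*-Solver
    instance _ = ℕ.m*n≢0⇒m≢0 L {{subst NonZero (sym L*L≡↧b) ℕ.nonZero}}
    lcm₀₁ = lcm (↧ₙ (x 0)) (↧ₙ (x 1))
    l = ℕ→ℚ lcm₀₁
    A = 1ℚ ⊔ (∣ x 0 ∣ ⊔ ∣ x 1 ∣)
    C = 1ℚ ⊔ ∣ b ∣
    lcm≤L = ∣⇒≤ (lcm-least (common 0) (common 1))
    l*l≤↧b : l * l ≤ ℕ→ℚ (↧ₙ b)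
    l*l≤↧b = subst₂ _≤_ (ℕ→ℚ-homo-* lcm₀₁ lcm₀₁) (cong ℕ→ℚ L*L≡↧b)
                        (ℕ→ℚ-mono-≤ (ℕ.*-mono-≤ lcm≤L lcm≤L))
    0≤A = ℚ.≤-trans (ℕ→ℚ-mono-≤ {0} {1} ℕ.z≤n) (ℚ.p≤p⊔q 1ℚ (∣ x 0 ∣ ⊔ ∣ x 1 ∣))
    A≤1⊔M = ℚ.⊔-monoʳ-≤ 1ℚ (ℚ.⊔-lub (∣x∣≤M 0) (∣x∣≤M 1))
    A*A≤9*C = ℚ.≤-trans (*-mono-≤-nonNeg 0≤A A≤1⊔M 0≤A A≤1⊔M)
                        (⊔-square-bound {M} {∣ b ∣} (ℚ.0≤∣p∣ b) M*M≤M+M+∣b∣)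

  square-denominator : SquareDenominator
  square-denominator = common⇒square orbitDenominator orbitDenominator-common

lemma18 : (b : ℚ) (Q : ℚ × ℚ) → IsPeriodic b Q →
    IsSquare (↧ₙ b) × (HQ Q * HQ Q ≤ (+ 9 / 1) * Hb b)
lemma18 b Q (zero , () , _)
lemma18 b Q (suc n , _ , periodic) =
  let (L , L*L≡↧b , _) = square-denominator in (L , sym L*L≡↧b) , height-bound square-denominator
  where open PeriodicOrbit b Q n periodic
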